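{- Let $A \ge B \ge C \ge 1$ be integers and let $R = \mathbb{Z}[x,y,z]/(x^A,y^B,z^C)$ with its standard grading $R=\bigoplus_r R_r$. For each $r$, let $h(r)$ be the number of monomials $x^iy^jz^k$ with $i+j+k=r$, $0\le i<A$, $0\le j<B$, $0\le k<C$, and let $U_r : R_r \to R_{r+1}$ be multiplication by $x+y+z$, written as an $h(r+1)\times h(r)$ integer matrix with respect to these monomial bases. Then for every $0 \le r \le A-2$, the Smith normal form of $U_r$ has all $h(r)$ of its diagonal entries equal to $1$. In particular, for every field $\Bbbk$ and every $0\le r\le A-2$, multiplication by $x+y+z$ from the degree-$r$ component to the degree-$(r+1)$ component of $\Bbbk[x,y,z]/(x^A,y^B,z^C)$ is injective.
   Context: For an $m\times n$ integer matrix $U$ with $m\ge n$, its Smith normal form is $(a_1,\dots,a_n)$ if there exist $P\in GL_m(\mathbb{Z})$, $Q\in GL_n(\mathbb{Z})$ such that $PUQ$ has diagonal entries $a_1,\dots,a_n$ (and all other entries zero) with $a_i \mid a_{i+1}$. -}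

module Defs where

open import Data.Nat as ℕ using (ℕ; zero; suc; _+_; _≟_)
open import Data.Integer as ℤ using (ℤ; +_) renaming (_+_ to _+ℤ_; _*_ to _*ℤ_)
open import Data.Integer.Divisibility as ℤD using () renaming (_∣_ to _∣ℤ_)
open import Data.Fin using (Fin; zero; suc; toℕ)
open import Data.List using (List; []; _∷_; length; lookup; concatMap; upTo; filterᵇ)
open import Data.Product using (Σ; _×_; _,_)
open import Data.Bool using (Bool; true; false; _∧_; if_then_else_)
open import Relation.Nullary.Decidable using (⌊_⌋)
open import Relation.Binary.PropositionalEquality using (_≡_)

-- Exponent triple (i , j , k) standing for the monomial x^i y^j z^k.
Mono : Set
Mono = ℕ × ℕ × ℕ

allMonos : ℕ → ℕ → ℕ → List Mono
allMonos A B C =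
  concatMap (λ i → concatMap (λ j → Data.List.map (λ k → (i , j , k)) (upTo C)) (upTo B)) (upTo A)

degree : Mono → ℕ
degree (i , j , k) = i + j + k

monos : ℕ → ℕ → ℕ → ℕ → List Mono
monos A B C r = filterᵇ (λ m → ⌊ degree m ≟ r ⌋) (allMonos A B C)

h : ℕ → ℕ → ℕ → ℕ → ℕ
h A B C r = length (monos A B C r)

basis : (A B C r : ℕ) → Fin (h A B C r) → Mono
basis A B C r = lookup (monos A B C r)

eqMono : Mono → Mono → Bool
eqMono (a , b , c) (i , j , k) = ⌊ a ≟ i ⌋ ∧ ⌊ b ≟ j ⌋ ∧ ⌊ c ≟ k ⌋

ind : Bool → ℤ
ind b = if b then + 1 else + 0

-- Coefficient of the basis monomial α in (x+y+z)·β computed in R: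
-- (x+y+z) x^i y^j z^k = x^(i+1)y^j z^k + x^i y^(j+1) z^k + x^i y^j z^(k+1),
-- where terms outside the basis vanish in R (they never equal a basis α).
mulCoeff : Mono → Mono → ℤ
mulCoeff α (i , j , k) =
  ind (eqMono α (suc i , j , k)) +ℤ ind (eqMono α (i , suc j , k)) +ℤ ind (eqMono α (i , j , suc k))

Matrix : ℕ → ℕ → Set
Matrix m n = Fin m → Fin n → ℤ

U : (A B C r : ℕ) → Matrix (h A B C (suc r)) (h A B C r)
U A B C r a b = mulCoeff (basis A B C (suc r) a) (basis A B C r b)

sumFin : (n : ℕ) → (Fin n → ℤ) → ℤ
sumFin zero    f = + 0
sumFin (suc n) f = f zero +ℤ sumFin n (λ i → f (suc i))

_⊗_ : {m n p : ℕ} → Matrix m n → Matrix n p → Matrix m p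
_⊗_ {n = n} M N i k = sumFin n (λ j → M i j *ℤ N j k)

identity : (n : ℕ) → Matrix n n
identity n i j = ind ⌊ toℕ i ≟ toℕ j ⌋

InGL : (n : ℕ) → Matrix n n → Set
InGL n M = Σ (Matrix n n) λ N →
  ((i j : Fin n) → (M ⊗ N) i j ≡ identity n i j) ×
  ((i j : Fin n) → (N ⊗ M) i j ≡ identity n i j)

diagMat : (m n : ℕ) → (Fin n → ℤ) → Matrix m n
diagMat m n d i j = if ⌊ toℕ i ≟ toℕ j ⌋ then d j else + 0

HasSmithNormalForm : (m n : ℕ) → Matrix m n → (Fin n → ℤ) → Set
HasSmithNormalForm m n M d =
  ((i j : Fin n) → suc (toℕ i) ≡ toℕ j → d i ∣ℤ d j) ×
  Σ (Matrix m m) λ P → Σ (Matrix n n) λ Q →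
    InGL m P × InGL n Q ×
    ((i : Fin m) (j : Fin n) → ((P ⊗ M) ⊗ Q) i j ≡ diagMat m n d i j)

-- The monomials of degree r + 1 are listed as those free of x followed by x·m for the
-- monomials m of degree r, in their own order; x·m stays inside the box because m has
-- x-exponent at most r ≤ A − 2.  The rows of U_r indexed by the x·m form a square matrix T
-- whose (m, m′) entry vanishes unless m = m′ (entry 1) or m′ has larger x-exponent than m:
-- T = I − N with N nilpotent, so T⁻¹ = I + N + ⋯ + N^r is integral.  Then U_r T⁻¹ has
-- the identity as lower block; subtracting combinations of these rows clears the upper
-- block, and a rotation of the rows moves the identity to the top, giving
-- P U_r T⁻¹ = diag(1, …, 1).

module Submission where

open import Defs
open import Data.Bool using (T; T?; true; false)
open import Data.Empty using (⊥-elim)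
open import Data.Fin as Fin using (Fin; zero; suc; toℕ; _↑ˡ_; _↑ʳ_; splitAt; join; cast)
open import Data.Fin.Permutation using (Permutation; _⟨$⟩ʳ_; _⟨$⟩ˡ_; inverseˡ; inverseʳ; cast-id)
import Data.Fin.Properties as Fin
open import Data.Fin.Properties using (+↔⊎)
open import Data.Integer as ℤ using (ℤ; +_; +0; -_) renaming (_+_ to _+ℤ_; _*_ to _*ℤ_; _-_ to _-ℤ_)
import Data.Integer.Properties as ℤ
open import Data.Integer.Tactic.RingSolver using (solve-∀)
open import Data.List
  using (List; []; _∷_; _++_; map; concatMap; cartesianProduct; cartesianProductWith; upTo; applyUpTo;
         filterᵇ; length; lookup)
open import Data.List.Membership.Propositional.Properties using (∈-lookup; ∈-filter⁻)
open import Data.List.Properties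
  using (map-∘; map-++; map-concatMap; concatMap-cong; map-upTo; filter-++; length-++; length-map)
import Data.List.Relation.Unary.All as All
open import Data.List.Relation.Unary.AllPairs using (_∷_)
open import Data.List.Relation.Unary.Unique.Propositional using (Unique)
import Data.List.Relation.Unary.Unique.Propositional.Properties as Unique
open import Data.Nat as ℕ using (ℕ; zero; suc; _≤_; _<_; _+_; z≤n; s≤s)
import Data.Nat.Divisibility as ℕ
import Data.Nat.Properties as ℕ
open import Data.Product using (_,_; _×_; proj₁; proj₂)
open import Data.Sum using ([_,_]; swap)
open import Data.Sum.Properties using (swap-↔)
import Data.Vec.Functional as V
import Data.Vec.Functional.Properties as V
open import Function using (_∘_; id)
open import Function.Properties.Inverse using (↔-trans; ↔-sym)
open import Level using (0ℓ)
open import Relation.Binary using (Setoid)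
import Relation.Binary.Reasoning.Setoid
open import Relation.Binary.PropositionalEquality
open import Relation.Nullary using (¬_; contradiction; yes; no)
open import Relation.Nullary.Decidable using (⌊_⌋; toWitness; fromWitness)

-- Finite sums

sumFin-cong : ∀ n {f g : Fin n → ℤ} → (∀ i → f i ≡ g i) → sumFin n f ≡ sumFin n g
sumFin-cong zero    f≗g = refl
sumFin-cong (suc n) f≗g = cong₂ _+ℤ_ (f≗g zero) (sumFin-cong n (f≗g ∘ suc))

sumFin-zero : ∀ n {f : Fin n → ℤ} → (∀ i → f i ≡ +0) → sumFin n f ≡ +0
sumFin-zero zero    f≗0 = refl
sumFin-zero (suc n) f≗0 = cong₂ _+ℤ_ (f≗0 zero) (sumFin-zero n (f≗0 ∘ suc))

sumFin-single : ∀ n (f : Fin n → ℤ) i → (∀ j → j ≢ i → f j ≡ +0) → sumFin n f ≡ f i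
sumFin-single (suc n) f zero    f≗0 =
  trans (cong (f zero +ℤ_) (sumFin-zero n (λ j → f≗0 (suc j) λ ()))) (ℤ.+-identityʳ (f zero))
sumFin-single (suc n) f (suc i) f≗0 =
  trans (cong (_+ℤ sumFin n (f ∘ suc)) (f≗0 zero λ ()))
        (trans (ℤ.+-identityˡ _)
               (sumFin-single n (f ∘ suc) i (λ j j≢i → f≗0 (suc j) (j≢i ∘ Fin.suc-injective))))

sumFin-+ : ∀ n (f g : Fin n → ℤ) → sumFin n (λ i → f i +ℤ g i) ≡ sumFin n f +ℤ sumFin n g
sumFin-+ zero    f g = refl
sumFin-+ (suc n) f g =
  trans (cong (f zero +ℤ g zero +ℤ_) (sumFin-+ n (f ∘ suc) (g ∘ suc)))
        (interchange (f zero) (g zero) (sumFin n (f ∘ suc)) _)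
  where interchange : ∀ a b c d → (a +ℤ b) +ℤ (c +ℤ d) ≡ (a +ℤ c) +ℤ (b +ℤ d)
        interchange = solve-∀

sumFin-hom : (φ : ℤ → ℤ) → φ +0 ≡ +0 → (∀ x y → φ (x +ℤ y) ≡ φ x +ℤ φ y) →
             ∀ n (f : Fin n → ℤ) → sumFin n (φ ∘ f) ≡ φ (sumFin n f)
sumFin-hom φ φ0 φ+ zero    f = sym φ0
sumFin-hom φ φ0 φ+ (suc n) f =
  trans (cong (φ (f zero) +ℤ_) (sumFin-hom φ φ0 φ+ n (f ∘ suc))) (sym (φ+ (f zero) _))

sumFin-neg : ∀ n (f : Fin n → ℤ) → sumFin n (λ i → - f i) ≡ - sumFin n f
sumFin-neg = sumFin-hom -_ refl ℤ.neg-distrib-+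

sumFin-*ˡ : ∀ n x (f : Fin n → ℤ) → sumFin n (λ i → x *ℤ f i) ≡ x *ℤ sumFin n f
sumFin-*ˡ n x = sumFin-hom (x *ℤ_) (ℤ.*-zeroʳ x) (ℤ.*-distribˡ-+ x) n

sumFin-*ʳ : ∀ n x (f : Fin n → ℤ) → sumFin n (λ i → f i *ℤ x) ≡ sumFin n f *ℤ x
sumFin-*ʳ n x = sumFin-hom (_*ℤ x) (ℤ.*-zeroˡ x) (λ a b → ℤ.*-distribʳ-+ x a b) n

sumFin-comm : ∀ n p (f : Fin n → Fin p → ℤ) →
              sumFin n (λ i → sumFin p (f i)) ≡ sumFin p (λ j → sumFin n (λ i → f i j))
sumFin-comm zero    p f = sym (sumFin-zero p (λ _ → refl))
sumFin-comm (suc n) p f =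
  trans (cong (sumFin p (f zero) +ℤ_) (sumFin-comm n p (f ∘ suc)))
        (sym (sumFin-+ p (f zero) (λ j → sumFin n (λ i → f (suc i) j))))

sumFin-++ : ∀ c n (f : Fin (c + n) → ℤ) →
            sumFin (c + n) f ≡ sumFin c (f ∘ (_↑ˡ n)) +ℤ sumFin n (f ∘ (c ↑ʳ_))
sumFin-++ zero    n f = sym (ℤ.+-identityˡ _)
sumFin-++ (suc c) n f =
  trans (cong (f zero +ℤ_) (sumFin-++ c n (f ∘ suc))) (sym (ℤ.+-assoc (f zero) _ _))

-- Matrix algebra

infix 4 _≈_
_≈_ : ∀ {m n} → Matrix m n → Matrix m n → Set
M ≈ N = ∀ i j → M i j ≡ N i j

≈-setoid : ℕ → ℕ → Setoid 0ℓ 0ℓ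
≈-setoid m n = record
  { Carrier       = Matrix m n
  ; _≈_           = _≈_
  ; isEquivalence = record
    { refl  = λ _ _ → refl
    ; sym   = λ M≈N i j → sym (M≈N i j)
    ; trans = λ M≈N N≈O i j → trans (M≈N i j) (N≈O i j)
    }
  }

module ≈-Reasoning (m n : ℕ) = Relation.Binary.Reasoning.Setoid (≈-setoid m n)

infixl 6 _⊕_ _⊖_
_⊕_ _⊖_ : ∀ {m n} → Matrix m n → Matrix m n → Matrix m n
(M ⊕ N) i j = M i j +ℤ N i j
(M ⊖ N) i j = M i j -ℤ N i j

ind-true : ∀ {b} → T b → ind b ≡ + 1
ind-true {true} _ = refl

ind-false : ∀ {b} → ¬ T b → ind b ≡ +0
ind-false {false} _  = refl
ind-false {true}  ¬t = contradiction _ ¬t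

identity-diag : ∀ {n} (i : Fin n) → identity n i i ≡ + 1
identity-diag i = ind-true (fromWitness refl)

identity-off : ∀ {n} {i j : Fin n} → i ≢ j → identity n i j ≡ +0
identity-off i≢j = ind-false (i≢j ∘ Fin.toℕ-injective ∘ toWitness)

selection : ∀ {m n} → (Fin m → Fin n) → Matrix m n
selection {n = n} f a = identity n (f a)

selection-⊗ : ∀ {m n p} (f : Fin m → Fin n) (X : Matrix n p) → selection f ⊗ X ≈ X ∘ f
selection-⊗ {n = n} f X a b =
  trans (sumFin-single n _ (f a) (λ a′ a′≢fa → cong (_*ℤ X a′ b) (identity-off (a′≢fa ∘ sym))))
        (trans (cong (_*ℤ X (f a) b) (identity-diag (f a))) (ℤ.*-identityˡ _))

module _ {m n : ℕ} where

  ⊗-identityˡ : (M : Matrix m n) → identity m ⊗ M ≈ M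
  ⊗-identityˡ = selection-⊗ id

  ⊗-identityʳ : (M : Matrix m n) → M ⊗ identity n ≈ M
  ⊗-identityʳ M i k =
    trans (sumFin-single n _ k (λ j j≢k → trans (cong (M i j *ℤ_) (identity-off j≢k)) (ℤ.*-zeroʳ (M i j))))
          (trans (cong (M i k *ℤ_) (identity-diag k)) (ℤ.*-identityʳ _))

module _ {m n p : ℕ} where

  ⊗-congˡ : {M M′ : Matrix m n} (N : Matrix n p) → M ≈ M′ → M ⊗ N ≈ M′ ⊗ N
  ⊗-congˡ N M≈M′ i k = sumFin-cong n (λ j → cong (_*ℤ N j k) (M≈M′ i j))

  ⊗-congʳ : (M : Matrix m n) {N N′ : Matrix n p} → N ≈ N′ → M ⊗ N ≈ M ⊗ N′
  ⊗-congʳ M N≈N′ i k = sumFin-cong n (λ j → cong (M i j *ℤ_) (N≈N′ j k))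

  ⊗-distribˡ-⊕ : (M : Matrix m n) (N O : Matrix n p) → M ⊗ (N ⊕ O) ≈ M ⊗ N ⊕ M ⊗ O
  ⊗-distribˡ-⊕ M N O i k =
    trans (sumFin-cong n (λ j → ℤ.*-distribˡ-+ (M i j) (N j k) (O j k))) (sumFin-+ n _ _)

  ⊗-distribʳ-⊕ : (M N : Matrix m n) (O : Matrix n p) → (M ⊕ N) ⊗ O ≈ M ⊗ O ⊕ N ⊗ O
  ⊗-distribʳ-⊕ M N O i k =
    trans (sumFin-cong n (λ j → ℤ.*-distribʳ-+ (O j k) (M i j) (N i j))) (sumFin-+ n _ _)

  ⊗-distribˡ-⊖ : (M : Matrix m n) (N O : Matrix n p) → M ⊗ (N ⊖ O) ≈ M ⊗ N ⊖ M ⊗ O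
  ⊗-distribˡ-⊖ M N O i k =
    trans (sumFin-cong n (λ j → *-distribˡ-- (M i j) (N j k) (O j k)))
          (trans (sumFin-+ n _ _) (cong ((M ⊗ N) i k +ℤ_) (sumFin-neg n _)))
    where *-distribˡ-- : ∀ x y z → x *ℤ (y -ℤ z) ≡ x *ℤ y +ℤ - (x *ℤ z)
          *-distribˡ-- = solve-∀

  ⊗-distribʳ-⊖ : (M N : Matrix m n) (O : Matrix n p) → (M ⊖ N) ⊗ O ≈ M ⊗ O ⊖ N ⊗ O
  ⊗-distribʳ-⊖ M N O i k =
    trans (sumFin-cong n (λ j → *-distribʳ-- (M i j) (N i j) (O j k)))
          (trans (sumFin-+ n _ _) (cong ((M ⊗ O) i k +ℤ_) (sumFin-neg n _)))
    where *-distribʳ-- : ∀ x y z → (x -ℤ y) *ℤ z ≡ x *ℤ z +ℤ - (y *ℤ z)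
          *-distribʳ-- = solve-∀

⊗-assoc : ∀ {m n p q} (M : Matrix m n) (N : Matrix n p) (O : Matrix p q) →
          (M ⊗ N) ⊗ O ≈ M ⊗ (N ⊗ O)
⊗-assoc {n = n} {p} M N O i l = begin
  sumFin p (λ k → sumFin n (λ j → M i j *ℤ N j k) *ℤ O k l)
    ≡⟨ sumFin-cong p (λ k → sym (sumFin-*ʳ n (O k l) _)) ⟩
  sumFin p (λ k → sumFin n (λ j → M i j *ℤ N j k *ℤ O k l))
    ≡⟨ sumFin-comm p n _ ⟩
  sumFin n (λ j → sumFin p (λ k → M i j *ℤ N j k *ℤ O k l))
    ≡⟨ sumFin-cong n (λ j → sumFin-cong p (λ k → ℤ.*-assoc (M i j) (N j k) (O k l))) ⟩
  sumFin n (λ j → sumFin p (λ k → M i j *ℤ (N j k *ℤ O k l)))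
    ≡⟨ sumFin-cong n (λ j → sumFin-*ˡ p (M i j) _) ⟩
  sumFin n (λ j → M i j *ℤ sumFin p (λ k → N j k *ℤ O k l)) ∎
  where open ≡-Reasoning

-- Invertibility over ℤ

⊕-cong : ∀ {m n} {M M′ N N′ : Matrix m n} → M ≈ M′ → N ≈ N′ → M ⊕ N ≈ M′ ⊕ N′
⊕-cong M≈M′ N≈N′ i j = cong₂ _+ℤ_ (M≈M′ i j) (N≈N′ i j)

InGL-cong : ∀ {n} {M M′ : Matrix n n} → M ≈ M′ → InGL n M → InGL n M′
InGL-cong M≈M′ (S , MS≈I , SM≈I) =
  S , (λ i j → trans (sym (⊗-congˡ S M≈M′ i j)) (MS≈I i j))
    , (λ i j → trans (sym (⊗-congʳ S M≈M′ i j)) (SM≈I i j))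

InGL-⊗ : ∀ {n} {M N : Matrix n n} → InGL n M → InGL n N → InGL n (M ⊗ N)
InGL-⊗ {n} {M} {N} (M⁻¹ , MM⁻¹≈I , M⁻¹M≈I) (N⁻¹ , NN⁻¹≈I , N⁻¹N≈I) =
  N⁻¹ ⊗ M⁻¹ , cancel M N N⁻¹ M⁻¹ NN⁻¹≈I MM⁻¹≈I , cancel N⁻¹ M⁻¹ M N M⁻¹M≈I N⁻¹N≈I
  where
  open ≈-Reasoning n n
  cancel : ∀ A B C D → B ⊗ C ≈ identity n → A ⊗ D ≈ identity n → (A ⊗ B) ⊗ (C ⊗ D) ≈ identity n
  cancel A B C D BC≈I AD≈I = begin
    (A ⊗ B) ⊗ (C ⊗ D) ≈⟨ ⊗-assoc A B (C ⊗ D) ⟩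
    A ⊗ (B ⊗ (C ⊗ D)) ≈⟨ ⊗-congʳ A (⊗-assoc B C D) ⟨
    A ⊗ ((B ⊗ C) ⊗ D) ≈⟨ ⊗-congʳ A (⊗-congˡ D BC≈I) ⟩
    A ⊗ (identity n ⊗ D) ≈⟨ ⊗-congʳ A (⊗-identityˡ D) ⟩
    A ⊗ D             ≈⟨ AD≈I ⟩
    identity n        ∎

module Nilpotent {n : ℕ} (N : Matrix n n) where

  private
    I : Matrix n n
    I = identity n

  power : ℕ → Matrix n n
  power zero    = I
  power (suc k) = N ⊗ power k

  geometric : ℕ → Matrix n n
  geometric zero    = I
  geometric (suc k) = I ⊕ N ⊗ geometric k

  telescope : ∀ k {X : Matrix n n} → X ≈ I ⊖ power (suc k) →
              (I ⊖ N) ⊕ N ⊗ X ≈ I ⊖ power (suc (suc k))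
  telescope k {X} X≈ i j = begin
    (I i j -ℤ N i j) +ℤ (N ⊗ X) i j
      ≡⟨ cong ((I i j -ℤ N i j) +ℤ_) (trans (⊗-congʳ N X≈ i j) (⊗-distribˡ-⊖ N I (power (suc k)) i j)) ⟩
    (I i j -ℤ N i j) +ℤ ((N ⊗ I) i j -ℤ power (suc (suc k)) i j)
      ≡⟨ cong (λ x → (I i j -ℤ N i j) +ℤ (x -ℤ power (suc (suc k)) i j)) (⊗-identityʳ N i j) ⟩
    (I i j -ℤ N i j) +ℤ (N i j -ℤ power (suc (suc k)) i j)
      ≡⟨ collapse (I i j) (N i j) _ ⟩
    I i j -ℤ power (suc (suc k)) i j ∎
    where open ≡-Reasoning
          collapse : ∀ x y z → (x -ℤ y) +ℤ (y -ℤ z) ≡ x -ℤ z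
          collapse = solve-∀

  geometric-⊗ : ∀ k → geometric k ⊗ (I ⊖ N) ≈ I ⊖ power (suc k)
  geometric-⊗ zero i j = trans (⊗-identityˡ (I ⊖ N) i j) (cong (I i j -ℤ_) (sym (⊗-identityʳ N i j)))
  geometric-⊗ (suc k) = begin
    (I ⊕ N ⊗ geometric k) ⊗ (I ⊖ N)          ≈⟨ ⊗-distribʳ-⊕ I (N ⊗ geometric k) (I ⊖ N) ⟩
    I ⊗ (I ⊖ N) ⊕ (N ⊗ geometric k) ⊗ (I ⊖ N)
      ≈⟨ ⊕-cong (⊗-identityˡ (I ⊖ N)) (⊗-assoc N (geometric k) (I ⊖ N)) ⟩
    (I ⊖ N) ⊕ N ⊗ (geometric k ⊗ (I ⊖ N))   ≈⟨ telescope k (geometric-⊗ k) ⟩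
    I ⊖ power (suc (suc k))                 ∎
    where open ≈-Reasoning n n

  ⊗-geometric : ∀ k → (I ⊖ N) ⊗ geometric k ≈ I ⊖ power (suc k)
  ⊗-geometric zero i j = trans (⊗-identityʳ (I ⊖ N) i j) (cong (I i j -ℤ_) (sym (⊗-identityʳ N i j)))
  ⊗-geometric (suc k) = begin
    (I ⊖ N) ⊗ (I ⊕ N ⊗ geometric k)          ≈⟨ ⊗-distribˡ-⊕ (I ⊖ N) I (N ⊗ geometric k) ⟩
    (I ⊖ N) ⊗ I ⊕ (I ⊖ N) ⊗ (N ⊗ geometric k) ≈⟨ ⊕-cong (⊗-identityʳ (I ⊖ N)) commute ⟩
    (I ⊖ N) ⊕ N ⊗ ((I ⊖ N) ⊗ geometric k)   ≈⟨ telescope k (⊗-geometric k) ⟩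
    I ⊖ power (suc (suc k))                 ∎
    where
    open ≈-Reasoning n n
    commute : (I ⊖ N) ⊗ (N ⊗ geometric k) ≈ N ⊗ ((I ⊖ N) ⊗ geometric k)
    commute = begin
      (I ⊖ N) ⊗ (N ⊗ geometric k)   ≈⟨ ⊗-assoc (I ⊖ N) N (geometric k) ⟨
      ((I ⊖ N) ⊗ N) ⊗ geometric k   ≈⟨ ⊗-congˡ (geometric k) (⊗-distribʳ-⊖ I N N) ⟩
      (I ⊗ N ⊖ N ⊗ N) ⊗ geometric k ≈⟨ ⊗-congˡ (geometric k) (λ i j → cong (_-ℤ (N ⊗ N) i j)
                                         (trans (⊗-identityˡ N i j) (sym (⊗-identityʳ N i j)))) ⟩
      (N ⊗ I ⊖ N ⊗ N) ⊗ geometric k ≈⟨ ⊗-congˡ (geometric k) (⊗-distribˡ-⊖ N I N) ⟨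
      (N ⊗ (I ⊖ N)) ⊗ geometric k   ≈⟨ ⊗-assoc N (I ⊖ N) (geometric k) ⟩
      N ⊗ ((I ⊖ N) ⊗ geometric k)   ∎

  nilpotent⇒InGL : ∀ K → (∀ i j → power (suc K) i j ≡ +0) → InGL n (I ⊖ N)
  nilpotent⇒InGL K Nᴷ≈0 =
    geometric K , (λ i j → trans (⊗-geometric K i j) (vanish i j))
                , (λ i j → trans (geometric-⊗ K i j) (vanish i j))
    where vanish : I ⊖ power (suc K) ≈ I
          vanish i j = trans (cong (I i j -ℤ_) (Nᴷ≈0 i j)) (ℤ.+-identityʳ (I i j))

  graded-power-vanishes : (ρ : Fin n → ℕ) → (∀ a b → ρ b ≤ ρ a → N a b ≡ +0) →
                          ∀ p a b → ρ b < ρ a + p → power p a b ≡ +0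
  graded-power-vanishes ρ N↑ zero a b ρb<ρa+0 =
    identity-off (λ { refl → ℕ.<-irrefl (sym (ℕ.+-identityʳ (ρ a))) ρb<ρa+0 })
  graded-power-vanishes ρ N↑ (suc p) a b ρb<ρa+1+p = sumFin-zero n term
    where
    term : ∀ c → N a c *ℤ power p c b ≡ +0
    term c with ρ c ℕ.≤? ρ a
    ... | yes ρc≤ρa = cong (_*ℤ power p c b) (N↑ a c ρc≤ρa)
    ... | no  ρc≰ρa = trans (cong (N a c *ℤ_) (graded-power-vanishes ρ N↑ p c b ρb<ρc+p)) (ℤ.*-zeroʳ (N a c))
      where ρb<ρc+p : ρ b < ρ c + p
            ρb<ρc+p = ℕ.<-≤-trans ρb<ρa+1+p
                        (ℕ.≤-trans (ℕ.≤-reflexive (ℕ.+-suc (ρ a) p)) (ℕ.+-monoˡ-≤ p (ℕ.≰⇒> ρc≰ρa)))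

unitriangular⇒InGL : ∀ {n} (T : Matrix n n) (ρ : Fin n → ℕ) K → (∀ b → ρ b ≤ K) →
                     (∀ a b → ρ b ≤ ρ a → T a b ≡ identity n a b) → InGL n T
unitriangular⇒InGL {n} T ρ K ρ≤K T↑ = InGL-cong I⊖N≈T (nilpotent⇒InGL K Nᴷ⁺¹≈0)
  where
  N : Matrix n n
  N = identity n ⊖ T
  open Nilpotent N
  N↑ : ∀ a b → ρ b ≤ ρ a → N a b ≡ +0
  N↑ a b ρb≤ρa = trans (cong (identity n a b -ℤ_) (T↑ a b ρb≤ρa)) (ℤ.+-inverseʳ (identity n a b))
  Nᴷ⁺¹≈0 : ∀ a b → power (suc K) a b ≡ +0
  Nᴷ⁺¹≈0 a b =
    graded-power-vanishes ρ N↑ (suc K) a b (ℕ.<-≤-trans (s≤s (ρ≤K b)) (ℕ.m≤n+m (suc K) (ρ a)))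
  I⊖N≈T : identity n ⊖ N ≈ T
  I⊖N≈T a b = sub-sub (identity n a b) (T a b)
    where sub-sub : ∀ x y → x -ℤ (x -ℤ y) ≡ y
          sub-sub = solve-∀

permutation-InGL : ∀ {m} (π : Permutation m m) → InGL m (selection (π ⟨$⟩ʳ_))
permutation-InGL {m} π =
  selection (π ⟨$⟩ˡ_) , selections-cancel (π ⟨$⟩ʳ_) (π ⟨$⟩ˡ_) (λ _ → inverseˡ π)
                      , selections-cancel (π ⟨$⟩ˡ_) (π ⟨$⟩ʳ_) (λ _ → inverseʳ π)
  where
  selections-cancel : ∀ (f g : Fin m → Fin m) → (∀ a → g (f a) ≡ a) →
                      selection f ⊗ selection g ≈ identity m
  selections-cancel f g g∘f≗id a b =
    trans (selection-⊗ f (selection g) a b) (cong (λ x → identity m x b) (g∘f≗id a))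

-- Smith normal form from an invertible block of rows

zeros ones : ∀ {n} → Fin n → ℤ
zeros _ = +0
ones  _ = + 1

module _ {c n : ℕ} where

  stack : ∀ {A : Set} → (Fin c → A) → (Fin n → A) → Fin (c + n) → A
  stack = V._++_

  stack-↑ˡ : ∀ {A : Set} (xs : Fin c → A) (ys : Fin n → A) k → stack xs ys (k ↑ˡ n) ≡ xs k
  stack-↑ˡ = V.lookup-++ˡ

  stack-↑ʳ : ∀ {A : Set} (xs : Fin c → A) (ys : Fin n → A) j → stack xs ys (c ↑ʳ j) ≡ ys j
  stack-↑ʳ = V.lookup-++ʳ

  ↑-elim : (P : Fin (c + n) → Set) → (∀ k → P (k ↑ˡ n)) → (∀ j → P (c ↑ʳ j)) → ∀ a → P a
  ↑-elim P upper lower a =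
    subst P (Fin.join-splitAt c n a) ([_,_] {C = P ∘ join c n} upper lower (splitAt c a))

  zero-over-identity : Matrix (c + n) n
  zero-over-identity = stack (λ _ → zeros) (identity n)

  -- Position j < n receives row c + j, position n + k receives row k.
  rotation : Permutation (c + n) (c + n)
  rotation = ↔-trans (cast-id (ℕ.+-comm c n)) (↔-trans (+↔⊎ {n} {c}) (↔-trans swap-↔ (↔-sym +↔⊎)))

  diagMat-rotation : ∀ a b → diagMat (c + n) n ones a b ≡ zero-over-identity (rotation ⟨$⟩ʳ a) b
  diagMat-rotation a b with toℕ a ℕ.<? n
  ... | yes a<n = begin
    diagMat (c + n) n ones a b
      ≡⟨ cong (λ x → ind ⌊ x ℕ.≟ toℕ b ⌋) (trans (Fin.toℕ-fromℕ< a′<n) (Fin.toℕ-cast _ a)) ⟨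
    identity n (Fin.fromℕ< a′<n) b
      ≡⟨ cong-app (stack-↑ʳ (λ _ → zeros) (identity n) _) b ⟨
    zero-over-identity (c ↑ʳ Fin.fromℕ< a′<n) b
      ≡⟨ cong (λ s → zero-over-identity (join c n (swap s)) b) (Fin.splitAt-< n a′ a′<n) ⟨
    zero-over-identity (rotation ⟨$⟩ʳ a) b ∎
    where
    open ≡-Reasoning
    a′ : Fin (n + c)
    a′ = cast (ℕ.+-comm c n) a
    a′<n : toℕ a′ < n
    a′<n = subst (_< n) (sym (Fin.toℕ-cast _ a)) a<n
  ... | no a≮n = begin
    diagMat (c + n) n ones a b
      ≡⟨ ind-false (λ a≡b → a≮n (subst (_< n) (sym (toWitness a≡b)) (Fin.toℕ<n b))) ⟩
    +0
      ≡⟨ cong-app (stack-↑ˡ (λ _ → zeros) (identity n) (Fin.reduce≥ a′ a′≥n)) b ⟨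
    zero-over-identity (Fin.reduce≥ a′ a′≥n ↑ˡ n) b
      ≡⟨ cong (λ s → zero-over-identity (join c n (swap s)) b) (Fin.splitAt-≥ n a′ a′≥n) ⟨
    zero-over-identity (rotation ⟨$⟩ʳ a) b ∎
    where
    open ≡-Reasoning
    a′ : Fin (n + c)
    a′ = cast (ℕ.+-comm c n) a
    a′≥n : n ≤ toℕ a′
    a′≥n = subst (n ≤_) (sym (Fin.toℕ-cast _ a)) (ℕ.≮⇒≥ a≮n)

  -- clear-upper W is the block matrix [I −W; 0 I].
  module _ (W : Matrix c n) where

    private
      N : Matrix (c + n) (c + n)
      N = stack (λ k → stack zeros (W k)) (λ _ → zeros)

      N-top : ∀ k → N (k ↑ˡ n) ≡ stack zeros (W k)
      N-top = stack-↑ˡ (λ k → stack zeros (W k)) (λ _ → zeros)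

      N-bottom : ∀ j → N (c ↑ʳ j) ≡ zeros
      N-bottom = stack-↑ʳ (λ k → stack zeros (W k)) (λ _ → zeros)

      N-top-left : ∀ k k′ → N (k ↑ˡ n) (k′ ↑ˡ n) ≡ +0
      N-top-left k k′ = trans (cong-app (N-top k) (k′ ↑ˡ n)) (stack-↑ˡ zeros (W k) k′)

      N-top-right : ∀ k j → N (k ↑ˡ n) (c ↑ʳ j) ≡ W k j
      N-top-right k j = trans (cong-app (N-top k) (c ↑ʳ j)) (stack-↑ʳ zeros (W k) j)

      G : Matrix (c + n) n
      G = stack W (identity n)

      N⊗G-top : ∀ k b → (N ⊗ G) (k ↑ˡ n) b ≡ W k b
      N⊗G-top k b = begin
        (N ⊗ G) (k ↑ˡ n) b
          ≡⟨ sumFin-++ c n _ ⟩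
        sumFin c (λ k′ → N (k ↑ˡ n) (k′ ↑ˡ n) *ℤ G (k′ ↑ˡ n) b) +ℤ
        sumFin n (λ j → N (k ↑ˡ n) (c ↑ʳ j) *ℤ G (c ↑ʳ j) b)
          ≡⟨ cong₂ _+ℤ_ (sumFin-zero c (λ k′ → cong (_*ℤ G (k′ ↑ˡ n) b) (N-top-left k k′)))
                        (sumFin-cong n (λ j → cong₂ _*ℤ_ (N-top-right k j) (cong-app (stack-↑ʳ W _ j) b))) ⟩
        +0 +ℤ (W ⊗ identity n) k b
          ≡⟨ trans (ℤ.+-identityˡ _) (⊗-identityʳ W k b) ⟩
        W k b ∎
        where open ≡-Reasoning

      N⊗G-bottom : ∀ j b → (N ⊗ G) (c ↑ʳ j) b ≡ +0
      N⊗G-bottom j b = sumFin-zero (c + n) (λ x → cong (λ row → row x *ℤ G x b) (N-bottom j))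

    clear-upper : Matrix (c + n) (c + n)
    clear-upper = identity (c + n) ⊖ N

    clear-upper-invertible : InGL (c + n) clear-upper
    clear-upper-invertible = unitriangular⇒InGL clear-upper level 1 level≤1
      (λ a b lb≤la → trans (cong (identity _ a b -ℤ_) (N-upper a b lb≤la)) (ℤ.+-identityʳ _))
      where
      level : Fin (c + n) → ℕ
      level = stack (λ _ → 0) (λ _ → 1)

      level≤1 : ∀ a → level a ≤ 1
      level≤1 = ↑-elim _ (λ k → subst (_≤ 1) (sym (stack-↑ˡ _ _ k)) z≤n)
                         (λ j → subst (_≤ 1) (sym (stack-↑ʳ _ _ j)) ℕ.≤-refl)

      N-upper : ∀ a b → level b ≤ level a → N a b ≡ +0
      N-upper = ↑-elim _ (λ k → ↑-elim _ (λ k′ _ → N-top-left k k′) (λ j → top-right k j))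
                         (λ j b _ → cong-app (N-bottom j) b)
        where
        top-right : ∀ k j → level (c ↑ʳ j) ≤ level (k ↑ˡ n) → N (k ↑ˡ n) (c ↑ʳ j) ≡ +0
        top-right k j 1≤0 = contradiction (subst₂ _≤_ (stack-↑ʳ _ _ j) (stack-↑ˡ _ _ k) 1≤0) λ ()

    clear-upper-⊗ : clear-upper ⊗ stack W (identity n) ≈ zero-over-identity
    clear-upper-⊗ a b = begin
      (clear-upper ⊗ G) a b
        ≡⟨ ⊗-distribʳ-⊖ (identity (c + n)) N G a b ⟩
      (identity (c + n) ⊗ G) a b -ℤ (N ⊗ G) a b
        ≡⟨ cong (_-ℤ (N ⊗ G) a b) (⊗-identityˡ G a b) ⟩
      G a b -ℤ (N ⊗ G) a b
        ≡⟨ ↑-elim (λ a → G a b -ℤ (N ⊗ G) a b ≡ zero-over-identity a b) upper lower a ⟩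
      zero-over-identity a b ∎
      where
      open ≡-Reasoning
      upper : ∀ k → G (k ↑ˡ n) b -ℤ (N ⊗ G) (k ↑ˡ n) b ≡ zero-over-identity (k ↑ˡ n) b
      upper k = trans (cong₂ _-ℤ_ (cong-app (stack-↑ˡ W _ k) b) (N⊗G-top k b))
                      (trans (ℤ.+-inverseʳ (W k b)) (sym (cong-app (stack-↑ˡ _ (identity n) k) b)))
      lower : ∀ j → G (c ↑ʳ j) b -ℤ (N ⊗ G) (c ↑ʳ j) b ≡ zero-over-identity (c ↑ʳ j) b
      lower j = trans (cong₂ _-ℤ_ (cong-app (stack-↑ʳ W _ j) b) (N⊗G-bottom j b))
                      (trans (ℤ.+-identityʳ _) (sym (cong-app (stack-↑ʳ _ (identity n) j) b)))

invertible-block⇒snf : ∀ {c n m} (e : c + n ≡ m) (M : Matrix m n) (T : Matrix n n) → InGL n T →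
                       (∀ j b → M (cast e (c ↑ʳ j)) b ≡ T j b) → HasSmithNormalForm m n M ones
invertible-block⇒snf {c} {n} refl M T (S , TS≈I , ST≈I) M-lower =
  (λ _ _ _ → ℕ.∣-refl) , P , S ,
  InGL-⊗ (permutation-InGL (rotation {c} {n})) (clear-upper-invertible W) , (T , ST≈I , TS≈I) ,
  PMS≈D
  where
  W : Matrix c n
  W k = (M ⊗ S) (k ↑ˡ n)

  R P : Matrix (c + n) (c + n)
  R = selection (rotation {c} {n} ⟨$⟩ʳ_)
  P = R ⊗ clear-upper W

  M⊗S≈stack : M ⊗ S ≈ stack W (identity n)
  M⊗S≈stack a b = ↑-elim (λ a → (M ⊗ S) a b ≡ stack W (identity n) a b) upper lower a
    where
    upper : ∀ k → (M ⊗ S) (k ↑ˡ n) b ≡ stack W (identity n) (k ↑ˡ n) b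
    upper k = sym (cong-app (stack-↑ˡ W _ k) b)
    lower : ∀ j → (M ⊗ S) (c ↑ʳ j) b ≡ stack W (identity n) (c ↑ʳ j) b
    lower j = trans (sumFin-cong n (λ x → cong (_*ℤ S x b) (M-lower′ j x)))
                    (trans (TS≈I j b) (sym (cong-app (stack-↑ʳ W _ j) b)))
      where M-lower′ : ∀ j x → M (c ↑ʳ j) x ≡ T j x
            M-lower′ j x = trans (cong (λ a → M a x) (sym (Fin.cast-is-id refl (c ↑ʳ j)))) (M-lower j x)

  PMS≈D : (P ⊗ M) ⊗ S ≈ diagMat (c + n) n ones
  PMS≈D = begin
    (P ⊗ M) ⊗ S                                    ≈⟨ ⊗-assoc P M S ⟩
    P ⊗ (M ⊗ S)                                    ≈⟨ ⊗-congʳ P M⊗S≈stack ⟩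
    (R ⊗ clear-upper W) ⊗ stack W (identity n)     ≈⟨ ⊗-assoc R (clear-upper W) _ ⟩
    R ⊗ (clear-upper W ⊗ stack W (identity n))     ≈⟨ ⊗-congʳ R (clear-upper-⊗ W) ⟩
    R ⊗ zero-over-identity {c} {n}                 ≈⟨ selection-⊗ (rotation {c} {n} ⟨$⟩ʳ_) _ ⟩
    zero-over-identity ∘ (rotation {c} {n} ⟨$⟩ʳ_)  ≈⟨ diagMat-rotation {c} {n} ⟨
    diagMat (c + n) n ones                         ∎
    where open ≈-Reasoning (c + n) n

-- The monomial bases

concatMap-map≡cartesianProductWith : ∀ {A B C : Set} (f : A → B → C) xs ys →
  concatMap (λ x → map (f x) ys) xs ≡ cartesianProductWith f xs ys
concatMap-map≡cartesianProductWith f []       ys = refl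
concatMap-map≡cartesianProductWith f (x ∷ xs) ys =
  cong (map (f x) ys ++_) (concatMap-map≡cartesianProductWith f xs ys)

length-++-map : ∀ {A B : Set} (f : A → B) xs ys {zs} → zs ≡ xs ++ map f ys →
                length xs + length ys ≡ length zs
length-++-map f xs ys refl = trans (cong (λ l → length xs + l) (sym (length-map f ys))) (sym (length-++ xs))

lookup-++-map : ∀ {A B : Set} (f : A → B) xs ys {zs} → zs ≡ xs ++ map f ys →
                .(e : length xs + length ys ≡ length zs) (j : Fin (length ys)) →
                lookup zs (cast e (length xs ↑ʳ j)) ≡ f (lookup ys j)
lookup-++-map f xs ys refl = go xs ys
  where
  go : ∀ xs ys .(e : length xs + length ys ≡ length (xs ++ map f ys)) j →
       lookup (xs ++ map f ys) (cast e (length xs ↑ʳ j)) ≡ f (lookup ys j)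
  go []       (y ∷ ys) e zero    = refl
  go []       (y ∷ ys) e (suc j) = go [] ys (ℕ.suc-injective e) j
  go (x ∷ xs) ys       e j       = go xs ys (ℕ.suc-injective e) j

lookup-injective : ∀ {A : Set} {xs : List A} → Unique xs → ∀ i j → lookup xs i ≡ lookup xs j → i ≡ j
lookup-injective {xs = _ ∷ _} _          zero    zero    _  = refl
lookup-injective              (x∉ ∷ _)   zero    (suc j) eq = contradiction eq (All.lookup x∉ (∈-lookup j))
lookup-injective              (x∉ ∷ _)   (suc i) zero    eq = contradiction (sym eq) (All.lookup x∉ (∈-lookup i))
lookup-injective              (_ ∷ uniq) (suc i) (suc j) eq = cong suc (lookup-injective uniq i j eq)

allMonos-cartesian : ∀ A B C → allMonos A B C ≡ cartesianProduct (upTo A) (cartesianProduct (upTo B) (upTo C))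
allMonos-cartesian A B C = begin
  concatMap (λ i → concatMap (λ j → map (λ k → (i , j , k)) (upTo C)) (upTo B)) (upTo A)
    ≡⟨ concatMap-cong (λ i → concatMap-cong (λ j → map-∘ (upTo C)) (upTo B)) (upTo A) ⟩
  concatMap (λ i → concatMap (map (i ,_) ∘ (λ j → map (j ,_) (upTo C))) (upTo B)) (upTo A)
    ≡⟨ concatMap-cong (λ i → map-concatMap (i ,_) _ (upTo B)) (upTo A) ⟨
  concatMap (λ i → map (i ,_) (concatMap (λ j → map (j ,_) (upTo C)) (upTo B))) (upTo A)
    ≡⟨ concatMap-cong (λ i → cong (map (i ,_)) (concatMap-map≡cartesianProductWith _,_ (upTo B) (upTo C)))
                      (upTo A) ⟩
  concatMap (λ i → map (i ,_) (cartesianProduct (upTo B) (upTo C))) (upTo A)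
    ≡⟨ concatMap-map≡cartesianProductWith _,_ (upTo A) _ ⟩
  cartesianProduct (upTo A) (cartesianProduct (upTo B) (upTo C)) ∎
  where open ≡-Reasoning

monos-unique : ∀ A B C r → Unique (monos A B C r)
monos-unique A B C r =
  Unique.filter⁺ _ (subst Unique (sym (allMonos-cartesian A B C))
                         (Unique.cartesianProduct⁺ (Unique.upTo⁺ A)
                            (Unique.cartesianProduct⁺ (Unique.upTo⁺ B) (Unique.upTo⁺ C))))

degree-basis : ∀ A B C r b → degree (basis A B C r b) ≡ r
degree-basis A B C r b =
  toWitness (proj₂ (∈-filter⁻ (T? ∘ λ m → ⌊ degree m ℕ.≟ r ⌋) {xs = allMonos A B C} (∈-lookup b)))

mulX : Mono → Mono
mulX (i , jk) = (suc i , jk)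

cartesianProduct-map-suc : ∀ xs (ys : List (ℕ × ℕ)) →
  cartesianProduct (map suc xs) ys ≡ map mulX (cartesianProduct xs ys)
cartesianProduct-map-suc []       ys = refl
cartesianProduct-map-suc (x ∷ xs) ys =
  trans (cong₂ _++_ (map-∘ ys) (cartesianProduct-map-suc xs ys)) (sym (map-++ _ (map (x ,_) ys) _))

xFreeMonos : ℕ → ℕ → List Mono
xFreeMonos B C = map (0 ,_) (cartesianProduct (upTo B) (upTo C))

allMonos-suc : ∀ A B C → allMonos (suc A) B C ≡ xFreeMonos B C ++ map mulX (allMonos A B C)
allMonos-suc A B C = begin
  allMonos (suc A) B C
    ≡⟨ allMonos-cartesian (suc A) B C ⟩
  map (0 ,_) Y ++ cartesianProduct (applyUpTo suc A) Y
    ≡⟨ cong (λ xs → map (0 ,_) Y ++ cartesianProduct xs Y) (map-upTo suc A) ⟨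
  map (0 ,_) Y ++ cartesianProduct (map suc (upTo A)) Y
    ≡⟨ cong (map (0 ,_) Y ++_) (cartesianProduct-map-suc (upTo A) Y) ⟩
  map (0 ,_) Y ++ map mulX (cartesianProduct (upTo A) Y)
    ≡⟨ cong (λ xs → map (0 ,_) Y ++ map mulX xs) (allMonos-cartesian A B C) ⟨
  map (0 ,_) Y ++ map mulX (allMonos A B C) ∎
  where
  open ≡-Reasoning
  Y : List (ℕ × ℕ)
  Y = cartesianProduct (upTo B) (upTo C)

ofDegree : ℕ → List Mono → List Mono
ofDegree r = filterᵇ (λ m → ⌊ degree m ℕ.≟ r ⌋)

ofDegree-mulX : ∀ r xs → ofDegree (suc r) (map mulX xs) ≡ map mulX (ofDegree r xs)
ofDegree-mulX r []       = refl
ofDegree-mulX r (x ∷ xs) with degree (mulX x) ℕ.≟ suc r | degree x ℕ.≟ r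
... | yes _         | yes _   = cong (mulX x ∷_) (ofDegree-mulX r xs)
... | no  _         | no  _   = ofDegree-mulX r xs
... | yes 1+d≡1+r   | no d≢r  = contradiction (ℕ.suc-injective 1+d≡1+r) d≢r
... | no  1+d≢1+r   | yes d≡r = contradiction (cong suc d≡r) 1+d≢1+r

ofDegree-zero-mulX : ∀ xs → ofDegree 0 (map mulX xs) ≡ []
ofDegree-zero-mulX []       = refl
ofDegree-zero-mulX (x ∷ xs) = ofDegree-zero-mulX xs

monos-suc : ∀ A B C r →
            monos (suc A) B C r ≡ ofDegree r (xFreeMonos B C) ++ ofDegree r (map mulX (allMonos A B C))
monos-suc A B C r = trans (cong (ofDegree r) (allMonos-suc A B C)) (filter-++ _ (xFreeMonos B C) _)

monos-shift : ∀ {A} B C r → r < A → monos (suc A) B C r ≡ monos A B C r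
monos-shift {suc A} B C r r<1+A = begin
  monos (suc (suc A)) B C r
    ≡⟨ monos-suc (suc A) B C r ⟩
  ofDegree r (xFreeMonos B C) ++ ofDegree r (map mulX (allMonos (suc A) B C))
    ≡⟨ cong (_ ++_) (shifted r r<1+A) ⟩
  ofDegree r (xFreeMonos B C) ++ ofDegree r (map mulX (allMonos A B C))
    ≡⟨ monos-suc A B C r ⟨
  monos (suc A) B C r ∎
  where
  open ≡-Reasoning
  shifted : ∀ r → r < suc A →
            ofDegree r (map mulX (allMonos (suc A) B C)) ≡ ofDegree r (map mulX (allMonos A B C))
  shifted zero    _         =
    trans (ofDegree-zero-mulX (allMonos (suc A) B C)) (sym (ofDegree-zero-mulX (allMonos A B C)))
  shifted (suc r) (s≤s r<A) =
    trans (ofDegree-mulX r (allMonos (suc A) B C))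
          (trans (cong (map mulX) (monos-shift B C r r<A)) (sym (ofDegree-mulX r (allMonos A B C))))

monos-split : ∀ {A} B C r → suc r < A →
              monos A B C (suc r) ≡ ofDegree (suc r) (xFreeMonos B C) ++ map mulX (monos A B C r)
monos-split {suc A} B C r (s≤s r<A) =
  trans (monos-suc A B C (suc r))
        (cong (_ ++_) (trans (ofDegree-mulX r (allMonos A B C)) (cong (map mulX) (sym (monos-shift B C r r<A)))))

-- The x-block of U_r

eqMono-sound : ∀ x y → T (eqMono x y) → x ≡ y
eqMono-sound (a , b , c) (i , j , k) t with a ℕ.≟ i | b ℕ.≟ j | c ℕ.≟ k
... | yes refl | yes refl | yes refl = refl
... | no _     | _        | _        = ⊥-elim t
... | yes _    | no _     | _        = ⊥-elim t
... | yes _    | yes _    | no _     = ⊥-elim t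

eqMono-refl : ∀ x → T (eqMono x x)
eqMono-refl (a , b , c) rewrite ℕ.≟-diag {a} refl | ℕ.≟-diag {b} refl | ℕ.≟-diag {c} refl = _

mulX-injective : ∀ {α β} → mulX α ≡ mulX β → α ≡ β
mulX-injective = cong λ { (i , jk) → (ℕ.pred i , jk) }

x-exponent≤degree : ∀ α → proj₁ α ≤ degree α
x-exponent≤degree (i , j , k) = ℕ.≤-trans (ℕ.m≤m+n i j) (ℕ.m≤m+n (i + j) k)

-- y·β and z·β keep the x-exponent of β, so they cannot equal x·α.
mulCoeff-mulX : ∀ α β → proj₁ β ≤ proj₁ α → mulCoeff (mulX α) β ≡ ind (eqMono (mulX α) (mulX β))
mulCoeff-mulX (i , j , k) (i′ , j′ , k′) i′≤i =
  trans (cong₂ (λ y z → ind (eqMono (suc i , j , k) (suc i′ , j′ , k′)) +ℤ y +ℤ z)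
               (ind-false (suc-i≢i′ ∘ eqMono-sound (suc i , j , k) (i′ , suc j′ , k′)))
               (ind-false (suc-i≢i′ ∘ eqMono-sound (suc i , j , k) (i′ , j′ , suc k′))))
        (trans (ℤ.+-identityʳ _) (ℤ.+-identityʳ _))
  where
  suc-i≢i′ : ∀ {y z : ℕ × ℕ} → _≢_ {A = Mono} (suc i , y) (i′ , z)
  suc-i≢i′ eq = ℕ.<-irrefl refl (ℕ.≤-trans (ℕ.≤-reflexive (cong proj₁ eq)) i′≤i)

xBlock : (A B C r : ℕ) → Matrix (h A B C r) (h A B C r)
xBlock A B C r a b = mulCoeff (mulX (basis A B C r a)) (basis A B C r b)

xBlock-invertible : ∀ A B C r → InGL (h A B C r) (xBlock A B C r)
xBlock-invertible A B C r = unitriangular⇒InGL (xBlock A B C r) (proj₁ ∘ α) r x≤r unitriangular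
  where
  α : Fin (h A B C r) → Mono
  α = basis A B C r
  x≤r : ∀ b → proj₁ (α b) ≤ r
  x≤r b = subst (proj₁ (α b) ≤_) (degree-basis A B C r b) (x-exponent≤degree (α b))
  unitriangular : ∀ a b → proj₁ (α b) ≤ proj₁ (α a) → xBlock A B C r a b ≡ identity _ a b
  unitriangular a b xb≤xa with a Fin.≟ b
  ... | yes refl = trans (mulCoeff-mulX (α a) (α a) xb≤xa)
                         (trans (ind-true (eqMono-refl (mulX (α a)))) (sym (identity-diag a)))
  ... | no  a≢b  = trans (mulCoeff-mulX (α a) (α b) xb≤xa)
                         (trans (ind-false (a≢b ∘ basis-injective ∘ mulX-injective ∘ eqMono-sound _ _))
                                (sym (identity-off a≢b)))
    where basis-injective : α a ≡ α b → a ≡ b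
          basis-injective = lookup-injective (monos-unique A B C r) a b

theorem1p1 : (A B C : ℕ) → B ≤ A → C ≤ B → 1 ≤ C →
    (r : ℕ) → r + 2 ≤ A →
    HasSmithNormalForm (h A B C (suc r)) (h A B C r) (U A B C r) (λ _ → + 1)
theorem1p1 A B C _ _ _ r r+2≤A =
  invertible-block⇒snf e (U A B C r) (xBlock A B C r) (xBlock-invertible A B C r) x-rows
  where
  Z : List Mono
  Z = ofDegree (suc r) (xFreeMonos B C)

  split : monos A B C (suc r) ≡ Z ++ map mulX (monos A B C r)
  split = monos-split B C r (subst (_≤ A) (ℕ.+-comm r 2) r+2≤A)

  e : length Z + h A B C r ≡ h A B C (suc r)
  e = length-++-map mulX Z (monos A B C r) split

  x-rows : ∀ j b → U A B C r (cast e (length Z ↑ʳ j)) b ≡ xBlock A B C r j b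
  x-rows j b = cong (λ α → mulCoeff α (basis A B C r b)) (lookup-++-map mulX Z (monos A B C r) split e j)
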